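{- For any positive integer $k$, $\dim_s(C_{2k+1}\times C_{2k+1})=(2k+1)(k+1)$.
   Context: $C_n$ is the cycle of order $n$. The direct product $G\times H$ has vertex set $V(G)\times V(H)$, with $(a,b)\sim(c,d)$ iff $ac\in E(G)$ and $bd\in E(H)$. For a connected graph $G$, $I_G[u,v]$ is the set of vertices on some shortest $u$–$v$ path. A vertex $w$ strongly resolves $u,v$ if $v\in I_G[u,w]$ or $u\in I_G[v,w]$. A strong resolving set is a set $S\subseteq V(G)$ such that every pair of vertices is strongly resolved by some vertex of $S$; $\dim_s(G)$ is the minimum cardinality of a strong resolving set. -}

module Defs where

open import Level using (Level; _⊔_) renaming (suc to lsuc)
open import Data.Nat using (ℕ; zero; suc; _+_; _*_; _≤_; _%_)
open import Data.Fin using (Fin; toℕ)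
open import Data.Product using (Σ; ∃; _×_; _,_)
open import Data.Sum using (_⊎_)
open import Data.List using (List; length)
open import Data.List.Membership.Propositional using (_∈_)
open import Data.List.Relation.Unary.Unique.Propositional using (Unique)
open import Relation.Binary.PropositionalEquality using (_≡_; _≢_)

Rel : Set → Set₁
Rel V = V → V → Set

module _ {V : Set} (Adj : Rel V) where

  -- walks u → v of length n (a shortest walk is a shortest path)
  data Walk : V → V → ℕ → Set where
    stop : ∀ v → Walk v v 0
    step : ∀ {u w v n} → Adj u w → Walk w v n → Walk u v (suc n)

  data On (x : V) : ∀ {u v n} → Walk u v n → Set where
    on-here  : ∀ {v n} (p : Walk x v n) → On x p
    on-there : ∀ {u w v n} (a : Adj u w) (p : Walk w v n) → On x p → On x (step a p)

  IsShortest : ∀ {u v n} → Walk u v n → Set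
  IsShortest {u} {v} {n} _ = ∀ m → Walk u v m → n ≤ m

  Interval : V → V → V → Set
  Interval u v x = Σ ℕ λ n → Σ (Walk u v n) λ p → IsShortest p × On x p

  StronglyResolves : V → V → V → Set
  StronglyResolves w u v = Interval u w v ⊎ Interval v w u

  IsStrongResolvingSet : List V → Set
  IsStrongResolvingSet S =
    ∀ u v → u ≢ v → ∃ λ w → w ∈ S × StronglyResolves w u v

  -- dim_s(G) = d : d is the minimum cardinality of a strong resolving set
  -- (sets are represented as duplicate-free lists)
  StrongMetricDim≡ : ℕ → Set
  StrongMetricDim≡ d =
    (∃ λ S → Unique S × IsStrongResolvingSet S × length S ≡ d)
    × (∀ S → Unique S → IsStrongResolvingSet S → d ≤ length S)

-- cycle C_{suc m} on vertex set Fin (suc m): i ~ j iff j ≡ i+1 or i ≡ j+1 (mod suc m)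
CycleAdj : (m : ℕ) → Rel (Fin (suc m))
CycleAdj m i j = (toℕ j ≡ (toℕ i + 1) % suc m) ⊎ (toℕ i ≡ (toℕ j + 1) % suc m)

DirectProduct : {V W : Set} → Rel V → Rel W → Rel (V × W)
DirectProduct AdjG AdjH (a , b) (c , d) = AdjG a c × AdjH b d

module Submission where

-- Let n = 2k + 1 and call u, q neighbours if they are adjacent in the Cartesian product
-- C_n □ C_n. Neighbours are at distance 2k in C_n × C_n, which is also its diameter: a walk
-- between them projects to closed walks of lengths m and m + 1 in the two coordinates, and
-- closed walks of length < n in C_n are even. Moreover every pair u, v lies on a walk of
-- length 2k from u to a neighbour of u. Consequently a pair of neighbours is strongly
-- resolved only by its own two vertices, while any set meeting every pair of neighbours
-- strongly resolves every pair. So dim_s is the vertex cover number of C_n □ C_n: each of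
-- its n rows is an odd cycle needing k + 1 vertices, and the vertices whose coordinate sum
-- is even modulo n form a cover with exactly k + 1 vertices per row.

open import Data.Bool using (Bool; true; false; T; if_then_else_)
open import Data.Empty using (⊥; ⊥-elim)
open import Data.Fin as Fin using (Fin; toℕ; fromℕ<)
open import Data.Fin.Properties using (toℕ-fromℕ<; toℕ-injective; toℕ<n)
open import Data.List using (List; []; _∷_; _++_; map; length; filter; tabulate; cartesianProduct; allFin)
import Data.List.Membership.DecPropositional as DecMembership
open import Data.List.Membership.Propositional using (_∈_)
open import Data.List.Membership.Propositional.Properties
  using (∈-∃++; ∈-++⁻; ∈-++⁺ˡ; ∈-++⁺ʳ; ∈-filter⁺; ∈-filter⁻; ∈-allFin; ∈-cartesianProduct⁺)
open import Data.List.Properties using (length-++; map-++; map-tabulate; map-∘)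
open import Data.List.Relation.Unary.All as All using ()
open import Data.List.Relation.Unary.AllPairs using (_∷_)
open import Data.List.Relation.Unary.Any using (here; there)
open import Data.List.Relation.Unary.Unique.Propositional using (Unique)
open import Data.List.Relation.Unary.Unique.Propositional.Properties using (filter⁺; cartesianProduct⁺; allFin⁺)
open import Data.Nat
open import Data.Nat.DivMod
open import Data.Nat.Divisibility using (_∣_; ∣m+n∣m⇒∣n; n∣m*n; n∣m⇒m%n≡0)
open import Data.Nat.ListAction using (sum)
open import Data.Nat.ListAction.Properties using (sum-++)
open import Data.Nat.Properties
open import Algebra.Properties.CommutativeSemigroup +-commutativeSemigroup using (interchange)
open import Data.Nat.Tactic.RingSolver using (solve)
open import Data.Product as Prod using (∃; ∃₂; _×_; _,_; proj₁; proj₂)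
open import Data.Product.Properties using (≡-dec)
open import Data.Sum as Sum using (_⊎_; inj₁; inj₂)
open import Function using (_∘_)
open import Level using (0ℓ)
open import Relation.Binary.PropositionalEquality
open import Relation.Nullary using (¬_; yes; no; does)
open import Relation.Nullary.Decidable using (T?)
open import Relation.Unary using (Pred; Decidable)

open import Defs

module _ {V : Set} {E : Rel V} where

  infixr 5 _++ʷ_

  _++ʷ_ : ∀ {u v w l₁ l₂} → Walk E u v l₁ → Walk E v w l₂ → Walk E u w (l₁ + l₂)
  stop _   ++ʷ q = q
  step a p ++ʷ q = step a (p ++ʷ q)

  on-++ʷ : ∀ {u v w l₁ l₂} (p : Walk E u v l₁) (q : Walk E v w l₂) → On E v (p ++ʷ q)
  on-++ʷ (stop _)   q = on-here q
  on-++ʷ (step a p) q = on-there a (p ++ʷ q) (on-++ʷ p q)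

  on-end : ∀ {u v l} (p : Walk E u v l) → On E v p
  on-end (stop v)   = on-here (stop v)
  on-end (step a p) = on-there a p (on-end p)

  on-split : ∀ {x u v l} {p : Walk E u v l} → On E x p →
             ∃₂ λ i j → Walk E u x i × Walk E x v j × i + j ≡ l
  on-split (on-here p) = 0 , _ , stop _ , p , refl
  on-split (on-there a p o) with on-split o
  ... | i , j , p₁ , p₂ , i+j≡l = suc i , j , step a p₁ , p₂ , cong suc i+j≡l

  Walk-0⇒≡ : ∀ {u v} → Walk E u v 0 → u ≡ v
  Walk-0⇒≡ (stop _) = refl

  cast-source : ∀ {u u′ v l} → u ≡ u′ → Walk E u v l → Walk E u′ v l
  cast-source refl p = p

  cast-target : ∀ {u v v′ l} → v ≡ v′ → Walk E u v l → Walk E u v′ l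
  cast-target refl p = p

  cast-length : ∀ {u v l l′} → l ≡ l′ → Walk E u v l → Walk E u v l′
  cast-length refl p = p

  module _ (E-sym : ∀ {x y} → E x y → E y x) where

    reverse : ∀ {u v l} → Walk E u v l → Walk E v u l
    reverse (stop v) = stop v
    reverse (step {n = l} a p) = cast-length (+-comm l 1) (reverse p ++ʷ step (E-sym a) (stop _))

mapʷ : ∀ {V W : Set} {E : Rel V} {F : Rel W} (f : V → W) → (∀ {x y} → E x y → F (f x) (f y)) →
       ∀ {u v l} → Walk E u v l → Walk F (f u) (f v) l
mapʷ f f-hom (stop v)   = stop (f v)
mapʷ f f-hom (step a p) = step (f-hom a) (mapʷ f f-hom p)

module _ {V : Set} (E : Rel V) where

  DistanceAtLeast : ℕ → V → V → Set
  DistanceAtLeast d u v = ∀ m → Walk E u v m → d ≤ m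

  DiameterAtMost : ℕ → Set
  DiameterAtMost d = ∀ u v → ∃ λ l → Walk E u v l × l ≤ d

  Via : ℕ → V → V → V → Set
  Via d u v q = ∃₂ λ l₁ l₂ → Walk E u v l₁ × Walk E v q l₂ × l₁ + l₂ ≡ d

module _ {V : Set} {E : Rel V} where

  via⇒interval : ∀ {d u v q} → DistanceAtLeast E d u q → Via E d u v q → Interval E u q v
  via⇒interval far (l₁ , l₂ , p , p′ , l₁+l₂≡d) =
    l₁ + l₂ , p ++ʷ p′ , subst (λ d → DistanceAtLeast E d _ _) (sym l₁+l₂≡d) far , on-++ʷ p p′

  interval-far-end : ∀ {d u v w} → DiameterAtMost E d → DistanceAtLeast E d u v →
                     Interval E u w v → v ≡ w
  interval-far-end {d} {u} {v} {w} diam far (l , p , p-shortest , v∈p) with on-split v∈p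
  ... | i , j , p₁ , p₂ , i+j≡l = Walk-0⇒≡ (subst (Walk E v w) j≡0 p₂)
    where
      i+j≤i+0 : i + j ≤ i + 0
      i+j≤i+0 = let (l′ , p′ , l′≤d) = diam u w in begin
        i + j ≡⟨ i+j≡l ⟩
        l     ≤⟨ p-shortest l′ p′ ⟩
        l′    ≤⟨ l′≤d ⟩
        d     ≤⟨ far i p₁ ⟩
        i     ≡⟨ +-identityʳ i ⟨
        i + 0 ∎
        where open ≤-Reasoning
      j≡0 : j ≡ 0
      j≡0 = n≤0⇒n≡0 (+-cancelˡ-≤ i j 0 i+j≤i+0)

  far-pair-resolvers : ∀ {d u q w} → DiameterAtMost E d →
                       DistanceAtLeast E d u q → DistanceAtLeast E d q u →
                       StronglyResolves E w u q → w ≡ u ⊎ w ≡ q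
  far-pair-resolvers diam far far′ (inj₁ q∈I[u,w]) = inj₂ (sym (interval-far-end diam far q∈I[u,w]))
  far-pair-resolvers diam far far′ (inj₂ u∈I[q,w]) = inj₁ (sym (interval-far-end diam far′ u∈I[q,w]))

  module _ (E-sym : ∀ {x y} → E x y → E y x) where

    distance-sym : ∀ {d u v} → DistanceAtLeast E d u v → DistanceAtLeast E d v u
    distance-sym far m p = far m (reverse E-sym p)

    via⇒interval-start : ∀ {d u v q} → DistanceAtLeast E d u q → Via E d u v q → Interval E v u u
    via⇒interval-start {d} {u} {v} {q} far (l₁ , l₂ , p , p′ , l₁+l₂≡d) =
      l₁ , reverse E-sym p , shortest , on-end (reverse E-sym p)
      where
        shortest : ∀ m → Walk E v u m → l₁ ≤ m
        shortest m r = +-cancelʳ-≤ l₂ l₁ m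
          (subst (_≤ m + l₂) (sym l₁+l₂≡d) (far (m + l₂) (reverse E-sym r ++ʷ p′)))

    vertex-cover⇒strong-resolving :
      ∀ {d} (R : Rel V) (S : List V) →
      (∀ {u q} → R u q → u ∈ S ⊎ q ∈ S) →
      (∀ {u q} → R u q → DistanceAtLeast E d u q) →
      (∀ u v → ∃ λ q → R u q × Via E d u v q) →
      IsStrongResolvingSet E S
    vertex-cover⇒strong-resolving R S cover far via u v _ with via u v
    ... | q , Ruq , uvq with cover Ruq
    ...   | inj₁ u∈S = u , u∈S , inj₂ (via⇒interval-start (far Ruq) uvq)
    ...   | inj₂ q∈S = q , q∈S , inj₁ (via⇒interval (far Ruq) uvq)

    strong-resolving⇒covers-far-pairs :
      ∀ {d u q} (S : List V) → DiameterAtMost E d → DistanceAtLeast E d u q → u ≢ q →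
      IsStrongResolvingSet E S → u ∈ S ⊎ q ∈ S
    strong-resolving⇒covers-far-pairs {u = u} {q} S diam far u≢q resolving
      with resolving u q u≢q
    ... | w , w∈S , w-resolves with far-pair-resolvers diam far (distance-sym far) w-resolves
    ...   | inj₁ refl = inj₁ w∈S
    ...   | inj₂ refl = inj₂ w∈S

even : ℕ → Bool
even zero          = true
even (suc zero)    = false
even (suc (suc m)) = even m

even-double : ∀ e → T (even (e + e))
even-double zero    = _
even-double (suc e) = subst (T ∘ even ∘ suc) (sym (+-suc e e)) (even-double e)

even-not-alternating : ∀ m → T (even m) → ¬ T (even (suc m))
even-not-alternating zero          _ ()
even-not-alternating (suc zero)    ()
even-not-alternating (suc (suc m)) = even-not-alternating m

even-or-even-suc : ∀ m → T (even m) ⊎ T (even (suc m))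
even-or-even-suc zero          = inj₁ _
even-or-even-suc (suc zero)    = inj₂ _
even-or-even-suc (suc (suc m)) = even-or-even-suc m

halve : ∀ d → ∃ λ e → d ≡ e + e ⊎ d ≡ suc (e + e)
halve zero          = 0 , inj₁ refl
halve (suc zero)    = 0 , inj₂ refl
halve (suc (suc d)) with halve d
... | e , inj₁ refl = suc e , inj₁ (cong suc (sym (+-suc e e)))
... | e , inj₂ refl = suc e , inj₂ (cong (suc ∘ suc) (sym (+-suc e e)))

split-length : ∀ {X Y k} → X ≤ Y → Y ≤ k →
  ∃₂ λ e f → X + (e + e) + (X + (f + f)) ≡ 2 * k ×
             (Y ≡ X + (e + e) ⊎ Y + (X + (e + e)) ≡ suc (2 * k))
split-length {X} X≤Y Y≤k with m≤n⇒∃[o]m+o≡n X≤Y | m≤n⇒∃[o]m+o≡n Y≤k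
... | d , refl | r , refl with halve d
...   | e , inj₁ refl = e , e + r , solve (X ∷ e ∷ r ∷ []) , inj₁ refl
...   | e , inj₂ refl = suc (e + r) , e , solve (X ∷ e ∷ r ∷ []) , inj₂ (solve (X ∷ e ∷ r ∷ []))

double-≤⇒ : ∀ k s → suc (2 * k) ≤ s + s → suc k ≤ s
double-≤⇒ k s 1+2k≤s+s = ≰⇒> λ s≤k → <⇒≱ 1+2k≤s+s (begin
  s + s        ≤⟨ +-mono-≤ s≤k s≤k ⟩
  k + k        ≡⟨ cong (k +_) (+-identityʳ k) ⟨
  2 * k        ∎)
  where open ≤-Reasoning

∑ : ℕ → (ℕ → ℕ) → ℕ
∑ zero    g = 0
∑ (suc m) g = g 0 + ∑ m (g ∘ suc)

∑-cong : ∀ m {f g} → (∀ j → j < m → f j ≡ g j) → ∑ m f ≡ ∑ m g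
∑-cong zero    f≗g = refl
∑-cong (suc m) f≗g = cong₂ _+_ (f≗g 0 z<s) (∑-cong m (λ j j<m → f≗g (suc j) (s<s j<m)))

∑-mono-≤ : ∀ m {f g} → (∀ j → f j ≤ g j) → ∑ m f ≤ ∑ m g
∑-mono-≤ zero    f≤g = z≤n
∑-mono-≤ (suc m) f≤g = +-mono-≤ (f≤g 0) (∑-mono-≤ m (f≤g ∘ suc))

∑-distrib-+ : ∀ m f g → ∑ m (λ j → f j + g j) ≡ ∑ m f + ∑ m g
∑-distrib-+ zero    f g = refl
∑-distrib-+ (suc m) f g = begin
  f 0 + g 0 + ∑ m (λ j → f (suc j) + g (suc j))  ≡⟨ cong (f 0 + g 0 +_) (∑-distrib-+ m (f ∘ suc) (g ∘ suc)) ⟩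
  f 0 + g 0 + (∑ m (f ∘ suc) + ∑ m (g ∘ suc))   ≡⟨ interchange (f 0) (g 0) _ _ ⟩
  f 0 + ∑ m (f ∘ suc) + (g 0 + ∑ m (g ∘ suc))   ∎
  where open ≡-Reasoning

∑-const : ∀ m c → ∑ m (λ _ → c) ≡ m * c
∑-const zero    c = refl
∑-const (suc m) c = cong (c +_) (∑-const m c)

∑-suc : ∀ m g → ∑ (suc m) g ≡ ∑ m g + g m
∑-suc zero    g = +-comm (g 0) 0
∑-suc (suc m) g = trans (cong (g 0 +_) (∑-suc m (g ∘ suc))) (sym (+-assoc (g 0) _ _))

∑-rotate : ∀ m g → g m ≡ g 0 → ∑ m (g ∘ suc) ≡ ∑ m g
∑-rotate zero    g gm≡g0 = refl
∑-rotate (suc m) g gm≡g0 = begin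
  ∑ (suc m) (g ∘ suc)       ≡⟨ ∑-suc m (g ∘ suc) ⟩
  ∑ m (g ∘ suc) + g (suc m) ≡⟨ cong (∑ m (g ∘ suc) +_) gm≡g0 ⟩
  ∑ m (g ∘ suc) + g 0       ≡⟨ +-comm _ (g 0) ⟩
  ∑ (suc m) g               ∎
  where open ≡-Reasoning

∑-shift : ∀ m g → (∀ j → g (j + m) ≡ g j) → ∀ i → ∑ m (λ j → g (i + j)) ≡ ∑ m g
∑-shift m g periodic zero    = refl
∑-shift m g periodic (suc i) = begin
  ∑ m (λ j → g (suc i + j))  ≡⟨ ∑-cong m (λ j _ → cong g (+-suc i j)) ⟨
  ∑ m (λ j → g (i + suc j))  ≡⟨ ∑-rotate m (λ j → g (i + j)) (trans (periodic i) (cong g (sym (+-identityʳ i)))) ⟩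
  ∑ m (λ j → g (i + j))      ≡⟨ ∑-shift m g periodic i ⟩
  ∑ m g                      ∎
  where open ≡-Reasoning

cyclic-cover-≥ : ∀ m c → c m ≡ c 0 → (∀ j → 1 ≤ c j + c (suc j)) → m ≤ ∑ m c + ∑ m c
cyclic-cover-≥ m c cm≡c0 covered = begin
  m                                ≡⟨ *-identityʳ m ⟨
  m * 1                            ≡⟨ ∑-const m 1 ⟨
  ∑ m (λ _ → 1)                    ≤⟨ ∑-mono-≤ m covered ⟩
  ∑ m (λ j → c j + c (suc j))      ≡⟨ ∑-distrib-+ m c (c ∘ suc) ⟩
  ∑ m c + ∑ m (c ∘ suc)            ≡⟨ cong (∑ m c +_) (∑-rotate m c cm≡c0) ⟩
  ∑ m c + ∑ m c                    ∎
  where open ≤-Reasoning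

sum-allFin : ∀ n (f : Fin n → ℕ) (g : ℕ → ℕ) → (∀ i → f i ≡ g (toℕ i)) →
             sum (map f (allFin n)) ≡ ∑ n g
sum-allFin n f g f≗g = trans (cong sum (map-tabulate (λ i → i) f)) (sum-tabulate n f g f≗g)
  where
    sum-tabulate : ∀ n (f : Fin n → ℕ) g → (∀ i → f i ≡ g (toℕ i)) → sum (tabulate f) ≡ ∑ n g
    sum-tabulate zero    f g f≗g = refl
    sum-tabulate (suc n) f g f≗g =
      cong₂ _+_ (f≗g Fin.zero) (sum-tabulate n (f ∘ Fin.suc) (g ∘ suc) (f≗g ∘ Fin.suc))

module _ {A : Set} where

  indicator : {P : Pred A 0ℓ} → Decidable P → A → ℕ
  indicator P? x = if does (P? x) then 1 else 0

  indicator-≥1 : ∀ {P : Pred A 0ℓ} (P? : Decidable P) {x} → P x → 1 ≤ indicator P? x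
  indicator-≥1 P? {x} px with P? x
  ... | yes _   = ≤-refl
  ... | no  ¬px = ⊥-elim (¬px px)

  length-filter : ∀ {P : Pred A 0ℓ} (P? : Decidable P) xs →
                  length (filter P? xs) ≡ sum (map (indicator P?) xs)
  length-filter P? []       = refl
  length-filter P? (x ∷ xs) with does (P? x)
  ... | true  = cong suc (length-filter P? xs)
  ... | false = length-filter P? xs

  Unique⇒length-≤ : ∀ {xs : List A} → Unique xs → ∀ ys → (∀ {x} → x ∈ xs → x ∈ ys) →
                    length xs ≤ length ys
  Unique⇒length-≤ {[]}     _           ys xs⊆ys = z≤n
  Unique⇒length-≤ {x ∷ xs} (x∉xs ∷ xs!) ys xs⊆ys with ∈-∃++ (xs⊆ys (here refl))
  ... | as , bs , refl = begin
    suc (length xs)            ≤⟨ s≤s (Unique⇒length-≤ xs! (as ++ bs) xs⊆as++bs) ⟩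
    suc (length (as ++ bs))    ≡⟨ cong suc (length-++ as) ⟩
    suc (length as + length bs) ≡⟨ +-suc (length as) (length bs) ⟨
    length as + length (x ∷ bs) ≡⟨ length-++ as ⟨
    length (as ++ x ∷ bs)      ∎
    where
      open ≤-Reasoning
      xs⊆as++bs : ∀ {z} → z ∈ xs → z ∈ as ++ bs
      xs⊆as++bs {z} z∈xs with ∈-++⁻ as (xs⊆ys (there z∈xs))
      ... | inj₁ z∈as          = ∈-++⁺ˡ z∈as
      ... | inj₂ (here refl)   = ⊥-elim (All.lookup x∉xs z∈xs refl)
      ... | inj₂ (there z∈bs)  = ∈-++⁺ʳ as z∈bs

module _ {A B : Set} where

  sum-cartesianProduct : ∀ (f : A × B → ℕ) xs ys →
    sum (map f (cartesianProduct xs ys)) ≡ sum (map (λ a → sum (map (λ b → f (a , b)) ys)) xs)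
  sum-cartesianProduct f []       ys = refl
  sum-cartesianProduct f (x ∷ xs) ys = begin
    sum (map f (map (x ,_) ys ++ cartesianProduct xs ys))
      ≡⟨ cong sum (map-++ f (map (x ,_) ys) _) ⟩
    sum (map f (map (x ,_) ys) ++ map f (cartesianProduct xs ys))
      ≡⟨ sum-++ (map f (map (x ,_) ys)) _ ⟩
    sum (map f (map (x ,_) ys)) + sum (map f (cartesianProduct xs ys))
      ≡⟨ cong₂ _+_ (cong sum (sym (map-∘ ys))) (sum-cartesianProduct f xs ys) ⟩
    _ ∎
    where open ≡-Reasoning

module Cycle (K : ℕ) where

  n : ℕ
  n = suc K

  C : Rel (Fin n)
  C = CycleAdj K

  C-sym : ∀ {i j} → C i j → C j i
  C-sym = Sum.swap

  %-+ˡ : ∀ a b → (a % n + b) % n ≡ (a + b) % n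
  %-+ˡ a b = begin
    (a % n + b) % n          ≡⟨ %-distribˡ-+ (a % n) b n ⟩
    (a % n % n + b % n) % n  ≡⟨ cong (λ t → (t + b % n) % n) (m%n%n≡m%n a n) ⟩
    (a % n + b % n) % n      ≡⟨ %-distribˡ-+ a b n ⟨
    (a + b) % n              ∎
    where open ≡-Reasoning

  %-+ʳ : ∀ a b → (a + b % n) % n ≡ (a + b) % n
  %-+ʳ a b = begin
    (a + b % n) % n  ≡⟨ cong (_% n) (+-comm a (b % n)) ⟩
    (b % n + a) % n  ≡⟨ %-+ˡ b a ⟩
    (b + a) % n      ≡⟨ cong (_% n) (+-comm b a) ⟩
    (a + b) % n      ∎
    where open ≡-Reasoning

  %-cong-+ʳ : ∀ a b c → a % n ≡ b % n → (a + c) % n ≡ (b + c) % n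
  %-cong-+ʳ a b c a≡b = begin
    (a + c) % n      ≡⟨ %-+ˡ a c ⟨
    (a % n + c) % n  ≡⟨ cong (λ t → (t + c) % n) a≡b ⟩
    (b % n + c) % n  ≡⟨ %-+ˡ b c ⟩
    (b + c) % n      ∎
    where open ≡-Reasoning

  %-+-≡⇒∣ : ∀ x d → (x + d) % n ≡ x % n → n ∣ d
  %-+-≡⇒∣ x d x+d≡x = ∣m+n∣m⇒∣n n∣x-rem+d (n∣m*n (x / n))
    where
      x-rem+d≡ : (x / n) * n + d ≡ ((x + d) / n) * n
      x-rem+d≡ = +-cancelˡ-≡ (x % n) _ _ (begin
        x % n + ((x / n) * n + d)          ≡⟨ +-assoc (x % n) _ d ⟨
        x % n + (x / n) * n + d            ≡⟨ cong (_+ d) (m≡m%n+[m/n]*n x n) ⟨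
        x + d                              ≡⟨ m≡m%n+[m/n]*n (x + d) n ⟩
        (x + d) % n + ((x + d) / n) * n    ≡⟨ cong (_+ ((x + d) / n) * n) x+d≡x ⟩
        x % n + ((x + d) / n) * n          ∎)
        where open ≡-Reasoning
      n∣x-rem+d : n ∣ (x / n) * n + d
      n∣x-rem+d = subst (n ∣_) (sym x-rem+d≡) (n∣m*n ((x + d) / n))

  ∣-<⇒≡0 : ∀ {d} → n ∣ d → d < n → d ≡ 0
  ∣-<⇒≡0 {d} n∣d d<n = trans (sym (m<n⇒m%n≡m d<n)) (n∣m⇒m%n≡0 d n n∣d)

  +-cancelˡ-%-≤ : ∀ i {a b} → a ≤ b → (i + b) % n ≡ (i + a) % n → b < n → b ≡ a
  +-cancelˡ-%-≤ i {a} {b} a≤b i+b≡i+a b<n = begin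
    b            ≡⟨ m+[n∸m]≡n a≤b ⟨
    a + (b ∸ a)  ≡⟨ cong (a +_) b∸a≡0 ⟩
    a + 0        ≡⟨ +-identityʳ a ⟩
    a            ∎
    where
      open ≡-Reasoning
      i+a+[b∸a]≡i+a : (i + a + (b ∸ a)) % n ≡ (i + a) % n
      i+a+[b∸a]≡i+a = trans (cong (_% n) (trans (+-assoc i a _) (cong (i +_) (m+[n∸m]≡n a≤b)))) i+b≡i+a
      b∸a≡0 : b ∸ a ≡ 0
      b∸a≡0 = ∣-<⇒≡0 (%-+-≡⇒∣ (i + a) (b ∸ a) i+a+[b∸a]≡i+a) (≤-<-trans (m∸n≤m b a) b<n)

  +-cancelˡ-% : ∀ i {a b} → (i + a) % n ≡ (i + b) % n → a < n → b < n → a ≡ b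
  +-cancelˡ-% i {a} {b} i+a≡i+b a<n b<n with ≤-total a b
  ... | inj₁ a≤b = sym (+-cancelˡ-%-≤ i a≤b (sym i+a≡i+b) b<n)
  ... | inj₂ b≤a = +-cancelˡ-%-≤ i b≤a i+a≡i+b a<n

  -- f and g count the steps taken forwards and backwards
  walk-invariant : ∀ {i j m} → Walk C i j m →
                   ∃₂ λ f g → f + g ≡ m × (toℕ i + f) % n ≡ (toℕ j + g) % n
  walk-invariant (stop _) = 0 , 0 , refl , refl
  walk-invariant {i} (step {w = w} (inj₁ w≡i+1) p) with walk-invariant p
  ... | f , g , f+g≡m , w+f≡j+g = suc f , g , cong suc f+g≡m , (begin
    (toℕ i + suc f) % n        ≡⟨ cong (_% n) (sym (+-assoc (toℕ i) 1 f)) ⟩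
    (toℕ i + 1 + f) % n        ≡⟨ %-+ˡ (toℕ i + 1) f ⟨
    ((toℕ i + 1) % n + f) % n  ≡⟨ cong (λ t → (t + f) % n) w≡i+1 ⟨
    (toℕ w + f) % n            ≡⟨ w+f≡j+g ⟩
    _                          ∎)
    where open ≡-Reasoning
  walk-invariant {i} {j} (step {w = w} (inj₂ i≡w+1) p) with walk-invariant p
  ... | f , g , f+g≡m , w+f≡j+g = f , suc g , trans (+-suc f g) (cong suc f+g≡m) , (begin
    (toℕ i + f) % n            ≡⟨ cong (λ t → (t + f) % n) i≡w+1 ⟩
    ((toℕ w + 1) % n + f) % n  ≡⟨ %-+ˡ (toℕ w + 1) f ⟩
    (toℕ w + 1 + f) % n        ≡⟨ cong (_% n) (+-comm-middle (toℕ w) 1 f) ⟩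
    (toℕ w + f + 1) % n        ≡⟨ %-cong-+ʳ (toℕ w + f) (toℕ j + g) 1 w+f≡j+g ⟩
    (toℕ j + g + 1) % n        ≡⟨ cong (_% n) (trans (+-assoc (toℕ j) g 1) (cong (toℕ j +_) (+-comm g 1))) ⟩
    (toℕ j + suc g) % n        ∎)
    where
      open ≡-Reasoning
      +-comm-middle : ∀ a b c → a + b + c ≡ a + c + b
      +-comm-middle a b c = trans (+-assoc a b c) (trans (cong (a +_) (+-comm b c)) (sym (+-assoc a c b)))

  closed-walk-even : ∀ {i m} → Walk C i i m → m < n → T (even m)
  closed-walk-even {i} {m} p m<n with walk-invariant p
  ... | f , g , f+g≡m , i+f≡i+g = subst (T ∘ even) (trans (cong (f +_) f≡g) f+g≡m) (even-double f)
    where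
      f≡g : f ≡ g
      f≡g = +-cancelˡ-% (toℕ i) i+f≡i+g
              (≤-<-trans (m≤m+n f g) (subst (_< n) (sym f+g≡m) m<n))
              (≤-<-trans (m≤n+m g f) (subst (_< n) (sym f+g≡m) m<n))

  adjacent-walk-odd : ∀ {i j m} → C i j → Walk C i j m → m < K → T (even (suc m))
  adjacent-walk-odd {i} {m = m} i~j p m<K =
    closed-walk-even (cast-length (+-comm m 1) (p ++ʷ step (C-sym i~j) (stop i))) (s≤s m<K)

  fin : ℕ → Fin n
  fin j = fromℕ< (m%n<n j n)

  toℕ-fin : ∀ j → toℕ (fin j) ≡ j % n
  toℕ-fin j = toℕ-fromℕ< (m%n<n j n)

  fin-cong-% : ∀ i j → i % n ≡ j % n → fin i ≡ fin j
  fin-cong-% i j i≡j = toℕ-injective (trans (toℕ-fin i) (trans i≡j (sym (toℕ-fin j))))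

  fin-toℕ : ∀ a → fin (toℕ a) ≡ a
  fin-toℕ a = toℕ-injective (trans (toℕ-fin (toℕ a)) (m<n⇒m%n≡m (toℕ<n a)))

  fin-+n : ∀ j → fin (j + n) ≡ fin j
  fin-+n j = fin-cong-% (j + n) j ([m+n]%n≡m%n j n)

  fin-suc-≢ : 1 < n → ∀ j → fin j ≢ fin (suc j)
  fin-suc-≢ 1<n j fin[j]≡fin[1+j] = 0≢1+n (+-cancelˡ-% j j+0≡j+1 z<s 1<n)
    where
      j+0≡j+1 : (j + 0) % n ≡ (j + 1) % n
      j+0≡j+1 = begin
        (j + 0) % n         ≡⟨ cong (_% n) (+-identityʳ j) ⟩
        j % n               ≡⟨ toℕ-fin j ⟨
        toℕ (fin j)         ≡⟨ cong toℕ fin[j]≡fin[1+j] ⟩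
        toℕ (fin (suc j))   ≡⟨ toℕ-fin (suc j) ⟩
        suc j % n           ≡⟨ cong (_% n) (+-comm 1 j) ⟩
        (j + 1) % n         ∎
        where open ≡-Reasoning

  C-fin-suc : ∀ j → C (fin j) (fin (suc j))
  C-fin-suc j = inj₁ (begin
    toℕ (fin (suc j))         ≡⟨ toℕ-fin (suc j) ⟩
    suc j % n                 ≡⟨ cong (_% n) (+-comm 1 j) ⟩
    (j + 1) % n               ≡⟨ %-+ˡ j 1 ⟨
    (j % n + 1) % n           ≡⟨ cong (λ t → (t + 1) % n) (toℕ-fin j) ⟨
    (toℕ (fin j) + 1) % n     ∎)
    where open ≡-Reasoning

  C-fin-+K : ∀ j → C (fin j) (fin (j + K))
  C-fin-+K j = subst (λ i → C i (fin (j + K))) fin[1+j+K]≡fin[j] (C-sym (C-fin-suc (j + K)))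
    where
      fin[1+j+K]≡fin[j] : fin (suc (j + K)) ≡ fin j
      fin[1+j+K]≡fin[j] = trans (cong fin (sym (+-suc j K))) (fin-+n j)

  fin-wrap : ∀ j {x X} → x + X ≡ n → fin (j + x + X) ≡ fin j
  fin-wrap j {x} {X} x+X≡n = trans (cong fin (trans (+-assoc j x X) (cong (j +_) x+X≡n))) (fin-+n j)

  forward : ∀ j t → Walk C (fin j) (fin (j + t)) t
  forward j zero    = cast-target (cong fin (sym (+-identityʳ j))) (stop _)
  forward j (suc t) = step (C-fin-suc j) (cast-target (cong fin (sym (+-suc j t))) (forward (suc j) t))

  backward : ∀ j t → Walk C (fin (j + t)) (fin j) t
  backward j t = reverse C-sym (forward j t)

  oscillate : ∀ j e → Walk C (fin j) (fin j) (e + e)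
  oscillate j e = forward j e ++ʷ backward j e

  _≡±_ : ℕ → ℕ → Set
  x ≡± X = x ≡ X ⊎ x + X ≡ n

  reach : ∀ j {x X} e → x ≡± X → Walk C (fin j) (fin (j + x)) (X + (e + e))
  reach j e (inj₁ refl)            = forward j _ ++ʷ oscillate (j + _) e
  reach j {x} e (inj₂ x+X≡n) = cast-source (fin-wrap j x+X≡n) (backward (j + x) _) ++ʷ oscillate (j + x) e

  straight-via : ∀ j {y m m′} → y ≡± m → m + m′ ≡ K →
    ∃ λ q → C (fin j) q × Walk C (fin j) (fin (j + y)) m × Walk C (fin (j + y)) q m′
  straight-via j {m = m} {m′} (inj₁ refl) m+m′≡K =
    fin (j + K) , C-fin-+K j , forward j m ,
    cast-target (cong fin (trans (+-assoc j m m′) (cong (j +_) m+m′≡K))) (forward (j + m) m′)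
  straight-via j {y} {m} {m′} (inj₂ y+m≡n) m+m′≡K =
    fin (suc j) , C-fin-suc j ,
    cast-source (fin-wrap j y+m≡n) (backward (j + y) m) ,
    cast-source (cong fin 1+j+m′≡j+y) (backward (suc j) m′)
    where
      y≡1+m′ : y ≡ suc m′
      y≡1+m′ = +-cancelʳ-≡ m y (suc m′) (trans y+m≡n (cong suc (trans (sym m+m′≡K) (+-comm m m′))))
      1+j+m′≡j+y : suc j + m′ ≡ j + y
      1+j+m′≡j+y = trans (sym (+-suc j m′)) (cong (j +_) (sym y≡1+m′))

  offset : ∀ a c → ∃ λ x → x < n × fin (toℕ a + x) ≡ c
  offset a c = y % n , m%n<n y n , (begin
    fin (toℕ a + y % n)  ≡⟨ fin-cong-% (toℕ a + y % n) (toℕ a + y) (%-+ʳ (toℕ a) y) ⟩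
    fin (toℕ a + y)      ≡⟨ cong fin a+y≡c+n ⟩
    fin (toℕ c + n)      ≡⟨ fin-+n (toℕ c) ⟩
    fin (toℕ c)          ≡⟨ fin-toℕ c ⟩
    c                    ∎)
    where
      open ≡-Reasoning
      y : ℕ
      y = toℕ c + (n ∸ toℕ a)
      a+y≡c+n : toℕ a + y ≡ toℕ c + n
      a+y≡c+n = begin
        toℕ a + (toℕ c + (n ∸ toℕ a))  ≡⟨ +-comm (toℕ a) _ ⟩
        toℕ c + (n ∸ toℕ a) + toℕ a    ≡⟨ +-assoc (toℕ c) _ _ ⟩
        toℕ c + (n ∸ toℕ a + toℕ a)    ≡⟨ cong (toℕ c +_) (m∸n+n≡m (<⇒≤ (toℕ<n a))) ⟩
        toℕ c + n                      ∎

module Torus (K : ℕ) where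
  open Cycle K public

  V : Set
  V = Fin n × Fin n

  G : Rel V
  G = DirectProduct C C

  G-sym : ∀ {u v} → G u v → G v u
  G-sym (a~c , b~d) = C-sym a~c , C-sym b~d

  CartesianAdj : V → V → Set
  CartesianAdj (a , b) (c , d) = (a ≡ c × C b d) ⊎ (C a c × b ≡ d)

  zipʷ : ∀ {a b c d m} → Walk C a c m → Walk C b d m → Walk G (a , b) (c , d) m
  zipʷ (stop _)   (stop _)   = stop _
  zipʷ (step x p) (step y q) = step (x , y) (zipʷ p q)

  cartesian-far : ∀ {u q} → CartesianAdj u q → DistanceAtLeast G K u q
  cartesian-far u~q m p = ≮⇒≥ (λ m<K → parity-clash u~q p m<K)
    where
      π₁ : ∀ {u v l} → Walk G u v l → Walk C (proj₁ u) (proj₁ v) l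
      π₁ = mapʷ proj₁ proj₁
      π₂ : ∀ {u v l} → Walk G u v l → Walk C (proj₂ u) (proj₂ v) l
      π₂ = mapʷ proj₂ proj₂
      parity-clash : ∀ {u q m} → CartesianAdj u q → Walk G u q m → m < K → ⊥
      parity-clash {m = m} (inj₁ (refl , b~d)) p m<K =
        even-not-alternating m (closed-walk-even (π₁ p) (m<n⇒m<1+n m<K)) (adjacent-walk-odd b~d (π₂ p) m<K)
      parity-clash {m = m} (inj₂ (a~c , refl)) p m<K =
        even-not-alternating m (closed-walk-even (π₂ p) (m<n⇒m<1+n m<K)) (adjacent-walk-odd a~c (π₁ p) m<K)

module OddTorus (k : ℕ) where
  open Torus (2 * k) public

  fold : ∀ {x} → x < n → ∃ λ X → x ≡± X × X ≤ k
  fold {x} x<n with x ≤? k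
  ... | yes x≤k = x , inj₁ refl , x≤k
  ... | no  x≰k = n ∸ x , inj₂ (m+[n∸m]≡n (<⇒≤ x<n)) , (begin
    n ∸ x        ≤⟨ ∸-monoʳ-≤ n (≰⇒> x≰k) ⟩
    n ∸ suc k    ≡⟨ cong (λ t → k + t ∸ k) (+-identityʳ k) ⟩
    k + k ∸ k    ≡⟨ m+n∸m≡n k k ⟩
    k            ∎)
    where open ≤-Reasoning

  ≡±-trans : ∀ {x Y m} → x ≡± Y → Y ≡± m → x ≡± m
  ≡±-trans (inj₁ refl)   Y≡±m           = Y≡±m
  ≡±-trans (inj₂ x+Y≡n) (inj₁ refl)    = inj₂ x+Y≡n
  ≡±-trans {x} {Y} {m} (inj₂ x+Y≡n) (inj₂ Y+m≡n) =
    inj₁ (+-cancelʳ-≡ Y x m (trans x+Y≡n (trans (sym Y+m≡n) (+-comm Y m))))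

  cartesian-swap : ∀ {u q} → CartesianAdj u q → CartesianAdj (Prod.swap u) (Prod.swap q)
  cartesian-swap (inj₁ (a≡c , b~d)) = inj₂ (b~d , a≡c)
  cartesian-swap (inj₂ (a~c , b≡d)) = inj₁ (b≡d , a~c)

  via-swap : ∀ {d u v q} → Via G d u v q → Via G d (Prod.swap u) (Prod.swap v) (Prod.swap q)
  via-swap (l₁ , l₂ , p , p′ , l₁+l₂≡d) = l₁ , l₂ , swapʷ p , swapʷ p′ , l₁+l₂≡d
    where
      swapʷ : ∀ {u v l} → Walk G u v l → Walk G (Prod.swap u) (Prod.swap v) l
      swapʷ = mapʷ Prod.swap Prod.swap

  ViaNeighbour : V → V → Set
  ViaNeighbour u v = ∃ λ q → CartesianAdj u q × Via G (2 * k) u v q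

  via-neighbour-swap : ∀ {u v} → ViaNeighbour (Prod.swap u) (Prod.swap v) → ViaNeighbour u v
  via-neighbour-swap (q , u~q , via) = Prod.swap q , cartesian-swap u~q , via-swap via

  -- The walk u → v → q of length m + m′ = 2k closes up in the first coordinate, which is
  -- possible since m and m′ have the parity of X and are at least X; in the second coordinate
  -- it goes straight round the cycle in the direction in which y is reached after m steps.
  via-neighbour-ordered : ∀ a b {x y X Y} → x ≡± X → y ≡± Y → X ≤ Y → Y ≤ k →
    ViaNeighbour (fin a , fin b) (fin (a + x) , fin (b + y))
  via-neighbour-ordered a b {X = X} x≡±X y≡±Y X≤Y Y≤k with split-length X≤Y Y≤k
  ... | e , f , m+m′≡2k , Y≡±m with straight-via b (≡±-trans y≡±Y Y≡±m) m+m′≡2k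
  ... | q₂ , b~q₂ , p₂ , p₂′ =
    (fin a , q₂) , inj₁ (refl , b~q₂) ,
    _ , _ , zipʷ (reach a e x≡±X) p₂ , zipʷ (reverse C-sym (reach a f x≡±X)) p₂′ , m+m′≡2k

  via-neighbour-fin : ∀ a b {x y X Y} → x ≡± X → y ≡± Y → X ≤ k → Y ≤ k →
    ViaNeighbour (fin a , fin b) (fin (a + x) , fin (b + y))
  via-neighbour-fin a b {X = X} {Y} x≡±X y≡±Y X≤k Y≤k with X ≤? Y
  ... | yes X≤Y = via-neighbour-ordered a b x≡±X y≡±Y X≤Y Y≤k
  ... | no  X≰Y = via-neighbour-swap (via-neighbour-ordered b a y≡±Y x≡±X (<⇒≤ (≰⇒> X≰Y)) X≤k)

  cycle-offset : ∀ a c → ∃₂ λ x X → fin (toℕ a + x) ≡ c × x ≡± X × X ≤ k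
  cycle-offset a c with offset a c
  ... | x , x<n , a+x≡c with fold x<n
  ...   | X , x≡±X , X≤k = x , X , a+x≡c , x≡±X , X≤k

  via-neighbour : ∀ u v → ViaNeighbour u v
  via-neighbour (a , b) (c , d) with cycle-offset a c | cycle-offset b d
  ... | x , X , a+x≡c , x≡±X , X≤k | y , Y , b+y≡d , y≡±Y , Y≤k =
    subst₂ ViaNeighbour (cong₂ _,_ (fin-toℕ a) (fin-toℕ b)) (cong₂ _,_ a+x≡c b+y≡d)
      (via-neighbour-fin (toℕ a) (toℕ b) x≡±X y≡±Y X≤k Y≤k)

  diameter : DiameterAtMost G (2 * k)
  diameter u v with via-neighbour u v
  ... | _ , _ , l₁ , l₂ , p , _ , l₁+l₂≡2k = l₁ , p , subst (l₁ ≤_) l₁+l₂≡2k (m≤m+n l₁ l₂)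

  vertices : List V
  vertices = cartesianProduct (allFin n) (allFin n)

  vertices-unique : Unique vertices
  vertices-unique = cartesianProduct⁺ (allFin⁺ n) (allFin⁺ n)

  ∈-vertices : ∀ v → v ∈ vertices
  ∈-vertices (a , b) = ∈-cartesianProduct⁺ (∈-allFin a) (∈-allFin b)

  σ : V → ℕ
  σ (a , b) = (toℕ a + toℕ b) % n

  σ<n : ∀ v → σ v < n
  σ<n (a , b) = m%n<n (toℕ a + toℕ b) n

  S? : Decidable (T ∘ even ∘ σ)
  S? v = T? (even (σ v))

  S : List V
  S = filter S? vertices

  ∈S : ∀ {v} → T (even (σ v)) → v ∈ S
  ∈S {v} = ∈-filter⁺ S? (∈-vertices v)

  even-or-even-next : ∀ s → s < n → T (even s) ⊎ T (even (suc s % n))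
  even-or-even-next s s<n with suc s <? n
  ... | yes 1+s<n = subst (λ t → T (even s) ⊎ T (even t)) (sym (m<n⇒m%n≡m 1+s<n)) (even-or-even-suc s)
  ... | no  1+s≮n = inj₁ (subst (T ∘ even) (sym s≡k+k) (even-double k))
    where
      s≡k+k : s ≡ k + k
      s≡k+k = trans (≤-antisym (≤-pred s<n) (≤-pred (≮⇒≥ 1+s≮n))) (cong (k +_) (+-identityʳ k))

  %-suc-+ : ∀ p r s → r ≡ (s + 1) % n → (p + r) % n ≡ suc ((p + s) % n) % n
  %-suc-+ p r s r≡s+1 = begin
    (p + r) % n               ≡⟨ cong (λ t → (p + t) % n) r≡s+1 ⟩
    (p + (s + 1) % n) % n     ≡⟨ %-+ʳ p (s + 1) ⟩
    (p + (s + 1)) % n         ≡⟨ cong (_% n) (+-assoc p s 1) ⟨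
    (p + s + 1) % n           ≡⟨ %-+ˡ (p + s) 1 ⟨
    ((p + s) % n + 1) % n     ≡⟨ cong (_% n) (+-comm _ 1) ⟩
    suc ((p + s) % n) % n     ∎
    where open ≡-Reasoning

  %-suc-+′ : ∀ p r s → r ≡ (s + 1) % n → (r + p) % n ≡ suc ((s + p) % n) % n
  %-suc-+′ p r s r≡s+1 = begin
    (r + p) % n             ≡⟨ cong (_% n) (+-comm r p) ⟩
    (p + r) % n             ≡⟨ %-suc-+ p r s r≡s+1 ⟩
    suc ((p + s) % n) % n   ≡⟨ cong (λ t → suc (t % n) % n) (+-comm p s) ⟩
    suc ((s + p) % n) % n   ∎
    where open ≡-Reasoning

  σ-step : ∀ {u q} → CartesianAdj u q → σ q ≡ suc (σ u) % n ⊎ σ u ≡ suc (σ q) % n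
  σ-step {a , b} {_ , d} (inj₁ (refl , inj₁ d≡b+1)) = inj₁ (%-suc-+ (toℕ a) (toℕ d) (toℕ b) d≡b+1)
  σ-step {a , b} {_ , d} (inj₁ (refl , inj₂ b≡d+1)) = inj₂ (%-suc-+ (toℕ a) (toℕ b) (toℕ d) b≡d+1)
  σ-step {a , b} {c , _} (inj₂ (inj₁ c≡a+1 , refl)) = inj₁ (%-suc-+′ (toℕ b) (toℕ c) (toℕ a) c≡a+1)
  σ-step {a , b} {c , _} (inj₂ (inj₂ a≡c+1 , refl)) = inj₂ (%-suc-+′ (toℕ b) (toℕ a) (toℕ c) a≡c+1)

  next-covered : ∀ {u q} → σ q ≡ suc (σ u) % n → u ∈ S ⊎ q ∈ S
  next-covered {u} σq≡ =
    Sum.map ∈S (∈S ∘ subst (T ∘ even) (sym σq≡)) (even-or-even-next (σ u) (σ<n u))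

  S-covers : ∀ {u q} → CartesianAdj u q → u ∈ S ⊎ q ∈ S
  S-covers u~q with σ-step u~q
  ... | inj₁ σq≡ = next-covered σq≡
  ... | inj₂ σu≡ = Sum.swap (next-covered σu≡)

  S-resolving : IsStrongResolvingSet G S
  S-resolving = vertex-cover⇒strong-resolving G-sym CartesianAdj S S-covers cartesian-far via-neighbour

  even-count : ∑ n (indicator (T? ∘ even)) ≡ suc k
  even-count = trans (cong (λ t → ∑ (suc (k + t)) (indicator (T? ∘ even))) (+-identityʳ k)) (count k)
    where
      count : ∀ k → ∑ (suc (k + k)) (indicator (T? ∘ even)) ≡ suc k
      count zero    = refl
      count (suc k) =
        trans (cong (λ t → ∑ (suc t) (indicator (T? ∘ even))) (+-suc (suc k) k)) (cong suc (count k))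

  S-row : ∀ a → sum (map (λ b → indicator (T? ∘ even) (σ (a , b))) (allFin n)) ≡ suc k
  S-row a = begin
    sum (map (λ b → ind (σ (a , b))) (allFin n))
      ≡⟨ sum-allFin n (λ b → ind (σ (a , b))) (λ j → ind ((toℕ a + j) % n)) (λ _ → refl) ⟩
    ∑ n (λ j → ind ((toℕ a + j) % n))
      ≡⟨ ∑-shift n (ind ∘ (_% n)) (λ j → cong ind ([m+n]%n≡m%n j n)) (toℕ a) ⟩
    ∑ n (λ j → ind (j % n))
      ≡⟨ ∑-cong n (λ j j<n → cong ind (m<n⇒m%n≡m j<n)) ⟩
    ∑ n ind
      ≡⟨ even-count ⟩
    suc k ∎
    where
      open ≡-Reasoning
      ind : ℕ → ℕ
      ind = indicator (T? ∘ even)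

  S-length : length S ≡ n * suc k
  S-length = begin
    length S
      ≡⟨ length-filter S? vertices ⟩
    sum (map (indicator S?) vertices)
      ≡⟨ sum-cartesianProduct (indicator S?) (allFin n) (allFin n) ⟩
    sum (map (λ a → sum (map (λ b → indicator S? (a , b)) (allFin n))) (allFin n))
      ≡⟨ sum-allFin n _ (λ _ → suc k) S-row ⟩
    ∑ n (λ _ → suc k)
      ≡⟨ ∑-const n (suc k) ⟩
    n * suc k ∎
    where open ≡-Reasoning

  open DecMembership (≡-dec (Fin._≟_ {n}) (Fin._≟_ {n})) using (_∈?_)

  row-count : List V → Fin n → ℕ
  row-count R a = sum (map (λ b → indicator (_∈? R) (a , b)) (allFin n))

  module _ (1≤k : 1 ≤ k) where

    row-covered : ∀ {R} → IsStrongResolvingSet G R → ∀ a j → (a , fin j) ∈ R ⊎ (a , fin (suc j)) ∈ R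
    row-covered R-resolving a j =
      strong-resolving⇒covers-far-pairs G-sym _ diameter (cartesian-far (inj₁ (refl , C-fin-suc j)))
        (fin-suc-≢ (s≤s (≤-trans 1≤k (m≤m+n k _))) j ∘ cong proj₂) R-resolving

    row-count-≥ : ∀ {R} → IsStrongResolvingSet G R → ∀ a → suc k ≤ row-count R a
    row-count-≥ {R} R-resolving a =
      double-≤⇒ k (row-count R a)
        (subst (λ s → n ≤ s + s) (sym row≡∑c) (cyclic-cover-≥ n c c[n]≡c[0] covered))
      where
        c : ℕ → ℕ
        c j = indicator (_∈? R) (a , fin j)
        row≡∑c : row-count R a ≡ ∑ n c
        row≡∑c = sum-allFin n _ c (λ b → cong (λ t → indicator (_∈? R) (a , t)) (sym (fin-toℕ b)))
        c[n]≡c[0] : c n ≡ c 0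
        c[n]≡c[0] = cong (λ t → indicator (_∈? R) (a , t)) (fin-+n 0)
        covered : ∀ j → 1 ≤ c j + c (suc j)
        covered j with row-covered R-resolving a j
        ... | inj₁ ∈R = ≤-trans (indicator-≥1 (_∈? R) ∈R) (m≤m+n (c j) (c (suc j)))
        ... | inj₂ ∈R = ≤-trans (indicator-≥1 (_∈? R) ∈R) (m≤n+m (c (suc j)) (c j))

    strong-resolving-length : ∀ R → Unique R → IsStrongResolvingSet G R → n * suc k ≤ length R
    strong-resolving-length R R-unique R-resolving = begin
      n * suc k                               ≡⟨ ∑-const n (suc k) ⟨
      ∑ n (λ _ → suc k)                       ≤⟨ ∑-mono-≤ n (row-count-≥ R-resolving ∘ fin) ⟩
      ∑ n (row-count R ∘ fin)                 ≡⟨ sum-allFin n _ (row-count R ∘ fin) (cong (row-count R) ∘ sym ∘ fin-toℕ) ⟨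
      sum (map (row-count R) (allFin n))      ≡⟨ sum-cartesianProduct (indicator (_∈? R)) (allFin n) (allFin n) ⟨
      sum (map (indicator (_∈? R)) vertices)  ≡⟨ length-filter (_∈? R) vertices ⟨
      length (filter (_∈? R) vertices)        ≤⟨ Unique⇒length-≤ (filter⁺ (_∈? R) vertices-unique) R
                                                   (λ {v} → proj₂ ∘ ∈-filter⁻ (_∈? R) {v} {vertices}) ⟩
      length R                                ∎
      where open ≤-Reasoning

proposition31 : (k : ℕ) → 1 ≤ k →
    StrongMetricDim≡ (DirectProduct (CycleAdj (2 * k)) (CycleAdj (2 * k)))
    ((2 * k + 1) * (k + 1))
proposition31 k 1≤k =
  (S , filter⁺ S? vertices-unique , S-resolving , trans S-length n*[1+k]≡) ,
  λ R R-unique R-resolving →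
    subst (_≤ length R) n*[1+k]≡ (strong-resolving-length 1≤k R R-unique R-resolving)
  where
    open OddTorus k
    n*[1+k]≡ : n * suc k ≡ (2 * k + 1) * (k + 1)
    n*[1+k]≡ = cong₂ _*_ (+-comm 1 (2 * k)) (+-comm 1 k)
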